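{- $g(Fano)=8$.
   Context: $Fano$ is the simple game on players $[7]$ whose minimal winning coalitions are the seven lines of the Fano plane $\{1,2,3\},\{3,4,5\},\{1,5,6\},\{1,4,7\},\{2,5,7\},\{3,6,7\},\{2,4,6\}$; a coalition is winning iff it contains one of these, otherwise losing. A trading transform of length $j$ is $(X_1,\dots,X_j;Y_1,\dots,Y_j)$, sequences of coalitions such that every player belongs to equally many $X_i$'s as $Y_i$'s; it is a certificate of non-weightedness if all $X_i$ are winning and all $Y_i$ losing, and it is potent if moreover the grand coalition $[7]$ is among the $X_i$ and $\emptyset$ is among the $Y_i$. For a game $G$, $g(G)$ is the length of the shortest potent certificate of non-weightedness for $G$ ($g(G)=\infty$ if $G$ is roughly weighted). -}

module Defs where

open import Data.Nat using (ℕ; zero; suc; _<_)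
open import Data.Fin using (Fin; zero; suc)
open import Data.Fin.Subset using (Subset; _⊆_; _∈_; ⊤; ⊥; ⁅_⁆; _∪_)
open import Data.Vec using (Vec; []; _∷_)
import Data.Vec
open import Data.Vec.Relation.Unary.Any using (Any)
open import Data.Bool using (Bool; true; false)
open import Data.Product using (Σ; ∃; _×_)
open import Data.List using (List; []; _∷_)
open import Data.List.Relation.Unary.Any as LAny using ()
open import Relation.Nullary using (¬_; Dec)
open import Relation.Binary.PropositionalEquality using (_≡_)
open import Relation.Nullary.Decidable using (⌊_⌋)

-- A coalition of players [n] (players 1..n represented by Fin n as 0..n-1).
Coalition : ℕ → Set
Coalition n = Subset n

-- A simple game given by its list of minimal winning coalitions:
-- a coalition is winning iff it contains one of them.
Winning : ∀ {n} → List (Coalition n) → Coalition n → Set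
Winning mins X = LAny.Any (λ M → M ⊆ X) mins

Losing : ∀ {n} → List (Coalition n) → Coalition n → Set
Losing mins X = ¬ Winning mins X

count : ∀ {n j} → Fin n → Vec (Coalition n) j → ℕ
count i [] = zero
count i (X ∷ Xs) with Data.Vec.lookup X i
... | true = suc (count i Xs)
... | false = count i Xs

IsTradingTransform : ∀ {n j} → Vec (Coalition n) j → Vec (Coalition n) j → Set
IsTradingTransform {n} Xs Ys = (i : Fin n) → count i Xs ≡ count i Ys

IsCertificate : ∀ {n j} → List (Coalition n) → Vec (Coalition n) j → Vec (Coalition n) j → Set
IsCertificate mins Xs Ys =
  IsTradingTransform Xs Ys
  × Data.Vec.Relation.Unary.All.All (Winning mins) Xs
  × Data.Vec.Relation.Unary.All.All (Losing mins) Ys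
  where import Data.Vec.Relation.Unary.All

IsPotentCertificate : ∀ {n j} → List (Coalition n) → Vec (Coalition n) j → Vec (Coalition n) j → Set
IsPotentCertificate mins Xs Ys =
  IsCertificate mins Xs Ys × Any (_≡ ⊤) Xs × Any (_≡ ⊥) Ys

HasPotentCertificateOfLength : ∀ {n} → List (Coalition n) → ℕ → Set
HasPotentCertificateOfLength {n} mins j =
  Σ (Vec (Coalition n) j) λ Xs → Σ (Vec (Coalition n) j) λ Ys → IsPotentCertificate mins Xs Ys

gEquals : ∀ {n} → List (Coalition n) → ℕ → Set
gEquals mins k =
  HasPotentCertificateOfLength mins k × ((j : ℕ) → j < k → ¬ HasPotentCertificateOfLength mins j)

p1 p2 p3 p4 p5 p6 p7 : Fin 7
p1 = zero
p2 = suc zero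
p3 = suc (suc zero)
p4 = suc (suc (suc zero))
p5 = suc (suc (suc (suc zero)))
p6 = suc (suc (suc (suc (suc zero))))
p7 = suc (suc (suc (suc (suc (suc zero)))))

line : Fin 7 → Fin 7 → Fin 7 → Coalition 7
line a b c = ⁅ a ⁆ ∪ (⁅ b ⁆ ∪ ⁅ c ⁆)

fanoLines : List (Coalition 7)
fanoLines =
  line p1 p2 p3 ∷ line p3 p4 p5 ∷ line p1 p5 p6 ∷ line p1 p4 p7 ∷
  line p2 p5 p7 ∷ line p3 p6 p7 ∷ line p2 p4 p6 ∷ []

-- A trading transform preserves the total size Σᵢ ∣Xᵢ∣ = Σᵢ ∣Yᵢ∣, since both sides count
-- the pairs (player, coalition containing it). In Fano every winning coalition has at least
-- 3 players and every losing one at most 4 (any 5 players contain a line). In a potent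
-- certificate of length j the grand coalition contributes 7 = 3 + 4 and ∅ contributes
-- 0 = 4 − 4, so 4 + 3j ≤ Σ ∣Xᵢ∣ = Σ ∣Yᵢ∣ ≤ 4j − 4, forcing j ≥ 8. Length 8 is attained by
-- the grand coalition with the seven lines against ∅ with their seven complements: every
-- player lies on three lines and outside four.
module Submission where

open import Defs
open import Data.Nat using (ℕ; zero; suc; _+_; _*_; _≤_; _<_; z≤n; _≟_; _≤?_)
open import Data.Nat.Properties
open import Algebra.Properties.CommutativeSemigroup +-commutativeSemigroup
  using (x∙yz≈y∙xz; x∙yz≈yx∙z; xy∙z≈xz∙y)
open import Data.Bool using (true; false)
import Data.Bool.Properties as Bool
open import Data.Fin using (Fin; zero; suc)
import Data.Fin.Properties as Fin
open import Data.Fin.Subset using (Subset; ⊤; ⊥; ∣_∣; inside; outside; ∁)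
open import Data.Fin.Subset.Properties using (_⊆?_; ∣⊤∣≡n; ∣⊥∣≡0)
open import Data.Vec using (Vec; []; _∷_; map; sum; tail; lookup; fromList)
open import Data.Vec.Properties using (≡-dec)
open import Data.Vec.Relation.Unary.All as All using (All; []; _∷_)
open import Data.Vec.Relation.Unary.Any as Any using (Any; here; there)
import Data.List.Relation.Unary.Any as ListAny
open import Data.List using (List)
open import Data.Product using (_,_)
open import Function using (_∘_)
open import Relation.Nullary using (¬_; ¬?)
open import Relation.Nullary.Decidable using (Dec; map′; _×-dec_; _→-dec_; from-yes)
open import Relation.Unary using (Pred; Decidable)
open import Relation.Binary.PropositionalEquality using (_≡_; refl; cong; cong₂; subst; sym; trans; module ≡-Reasoning)

private
  variable
    n j : ℕ

totalSize : Vec (Subset n) j → ℕ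
totalSize = sum ∘ map ∣_∣

totalSize-players-zero : (Xs : Vec (Subset 0) j) → totalSize Xs ≡ 0
totalSize-players-zero []        = refl
totalSize-players-zero ([] ∷ Xs) = totalSize-players-zero Xs

count-suc : (i : Fin n) (Xs : Vec (Subset (suc n)) j) → count (suc i) Xs ≡ count i (map tail Xs)
count-suc i []              = refl
count-suc i ((_ ∷ X) ∷ Xs) with lookup X i
... | true  = cong suc (count-suc i Xs)
... | false = count-suc i Xs

totalSize-split : (Xs : Vec (Subset (suc n)) j) → totalSize Xs ≡ count zero Xs + totalSize (map tail Xs)
totalSize-split []                   = refl
totalSize-split ((inside  ∷ X) ∷ Xs) =
  cong suc (trans (cong (∣ X ∣ +_) (totalSize-split Xs)) (x∙yz≈y∙xz ∣ X ∣ (count zero Xs) _))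
totalSize-split ((outside ∷ X) ∷ Xs) =
  trans (cong (∣ X ∣ +_) (totalSize-split Xs)) (x∙yz≈y∙xz ∣ X ∣ (count zero Xs) _)

tradingTransform-tail : (Xs Ys : Vec (Subset (suc n)) j) →
                        IsTradingTransform Xs Ys → IsTradingTransform (map tail Xs) (map tail Ys)
tradingTransform-tail Xs Ys trade i =
  trans (sym (count-suc i Xs)) (trans (trade (suc i)) (count-suc i Ys))

tradingTransform⇒totalSize≡ : (Xs Ys : Vec (Subset n) j) → IsTradingTransform Xs Ys → totalSize Xs ≡ totalSize Ys
tradingTransform⇒totalSize≡ {n = zero}  Xs Ys _ =
  trans (totalSize-players-zero Xs) (sym (totalSize-players-zero Ys))
tradingTransform⇒totalSize≡ {n = suc n} Xs Ys trade = begin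
  totalSize Xs                              ≡⟨ totalSize-split Xs ⟩
  count zero Xs + totalSize (map tail Xs)   ≡⟨ cong₂ _+_ (trade zero) tails ⟩
  count zero Ys + totalSize (map tail Ys)   ≡⟨ sym (totalSize-split Ys) ⟩
  totalSize Ys                              ∎
  where
    open ≡-Reasoning
    tails : totalSize (map tail Xs) ≡ totalSize (map tail Ys)
    tails = tradingTransform⇒totalSize≡ (map tail Xs) (map tail Ys) (tradingTransform-tail Xs Ys trade)

module _ {a : ℕ} where

  totalSize-lowerBound : {Xs : Vec (Subset n) j} → All (λ X → a ≤ ∣ X ∣) Xs → j * a ≤ totalSize Xs
  totalSize-lowerBound []           = z≤n
  totalSize-lowerBound (a≤X ∷ a≤Xs) = +-mono-≤ a≤X (totalSize-lowerBound a≤Xs)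

  totalSize-lowerBound-surplus : ∀ {d} {Xs : Vec (Subset n) j} → All (λ X → a ≤ ∣ X ∣) Xs →
                                 Any (λ X → a + d ≤ ∣ X ∣) Xs → d + j * a ≤ totalSize Xs
  totalSize-lowerBound-surplus {j = suc j} {d} (_ ∷ a≤Xs) (here a+d≤X) = begin
    d + (a + j * a)   ≡⟨ x∙yz≈yx∙z d a (j * a) ⟩
    a + d + j * a     ≤⟨ +-mono-≤ a+d≤X (totalSize-lowerBound a≤Xs) ⟩
    _                 ∎
    where open ≤-Reasoning
  totalSize-lowerBound-surplus {j = suc j} {d} (a≤X ∷ a≤Xs) (there surplus) = begin
    d + (a + j * a)   ≡⟨ x∙yz≈y∙xz d a (j * a) ⟩
    a + (d + j * a)   ≤⟨ +-mono-≤ a≤X (totalSize-lowerBound-surplus a≤Xs surplus) ⟩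
    _                 ∎
    where open ≤-Reasoning

module _ {b : ℕ} where

  totalSize-upperBound : {Ys : Vec (Subset n) j} → All (λ Y → ∣ Y ∣ ≤ b) Ys → totalSize Ys ≤ j * b
  totalSize-upperBound []           = z≤n
  totalSize-upperBound (Y≤b ∷ Ys≤b) = +-mono-≤ Y≤b (totalSize-upperBound Ys≤b)

  totalSize-upperBound-deficit : ∀ {e} {Ys : Vec (Subset n) j} → All (λ Y → ∣ Y ∣ ≤ b) Ys →
                                 Any (λ Y → ∣ Y ∣ + e ≤ b) Ys → totalSize Ys + e ≤ j * b
  totalSize-upperBound-deficit {e = e} {Y ∷ Ys} (_ ∷ Ys≤b) (here Y+e≤b) = begin
    ∣ Y ∣ + totalSize Ys + e   ≡⟨ xy∙z≈xz∙y ∣ Y ∣ (totalSize Ys) e ⟩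
    ∣ Y ∣ + e + totalSize Ys   ≤⟨ +-mono-≤ Y+e≤b (totalSize-upperBound Ys≤b) ⟩
    _                          ∎
    where open ≤-Reasoning
  totalSize-upperBound-deficit {e = e} {Y ∷ Ys} (Y≤b ∷ Ys≤b) (there deficit) = begin
    ∣ Y ∣ + totalSize Ys + e   ≡⟨ +-assoc ∣ Y ∣ (totalSize Ys) e ⟩
    ∣ Y ∣ + (totalSize Ys + e) ≤⟨ +-mono-≤ Y≤b (totalSize-upperBound-deficit Ys≤b deficit) ⟩
    _                          ∎
    where open ≤-Reasoning

potentCertificate⇒length-bound :
  {mins : List (Subset n)} {a b d e : ℕ} →
  (∀ X → Winning mins X → a ≤ ∣ X ∣) → (∀ Y → Losing mins Y → ∣ Y ∣ ≤ b) →
  a + d ≤ n → e ≤ b → HasPotentCertificateOfLength mins j → d + j * a + e ≤ j * b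
potentCertificate⇒length-bound {n = n} {j = j} {a = a} {b} {d} {e} winning⇒a≤ losing⇒≤b a+d≤n e≤b
  (Xs , Ys , (trade , winning , losing) , ⊤∈Xs , ⊥∈Ys) = begin
    d + j * a + e      ≤⟨ +-monoˡ-≤ e (totalSize-lowerBound-surplus a≤Xs (Any.map grand-surplus ⊤∈Xs)) ⟩
    totalSize Xs + e   ≡⟨ cong (_+ e) (tradingTransform⇒totalSize≡ Xs Ys trade) ⟩
    totalSize Ys + e   ≤⟨ totalSize-upperBound-deficit Ys≤b (Any.map empty-deficit ⊥∈Ys) ⟩
    j * b              ∎
  where
    open ≤-Reasoning
    a≤Xs : All (λ X → a ≤ ∣ X ∣) Xs
    a≤Xs = All.map (winning⇒a≤ _) winning
    Ys≤b : All (λ Y → ∣ Y ∣ ≤ b) Ys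
    Ys≤b = All.map (losing⇒≤b _) losing
    grand-surplus : ∀ {X} → X ≡ ⊤ → a + d ≤ ∣ X ∣
    grand-surplus refl = subst (a + d ≤_) (sym (∣⊤∣≡n n)) a+d≤n
    empty-deficit : ∀ {Y} → Y ≡ ⊥ → ∣ Y ∣ + e ≤ b
    empty-deficit refl = subst (λ k → k + e ≤ b) (sym (∣⊥∣≡0 n)) e≤b

allSubsets? : ∀ {ℓ} {P : Pred (Subset n) ℓ} → Decidable P → Dec (∀ X → P X)
allSubsets? {n = zero}  P? = map′ (λ { P[] [] → P[] }) (λ ∀P → ∀P []) (P? [])
allSubsets? {n = suc n} P? = map′
  (λ { (∀Pin , ∀Pout) (inside ∷ X) → ∀Pin X ; (∀Pin , ∀Pout) (outside ∷ X) → ∀Pout X })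
  (λ ∀P → ∀P ∘ (inside ∷_) , ∀P ∘ (outside ∷_))
  (allSubsets? (P? ∘ (inside ∷_)) ×-dec allSubsets? (P? ∘ (outside ∷_)))

winning? : (mins : List (Subset n)) → Decidable (Winning mins)
winning? mins X = ListAny.any? (_⊆? X) mins

_≟ˢ_ : (X Y : Subset n) → Dec (X ≡ Y)
_≟ˢ_ = ≡-dec Bool._≟_

potentCertificate? : (mins : List (Subset n)) (Xs Ys : Vec (Subset n) j) →
                     Dec (IsPotentCertificate mins Xs Ys)
potentCertificate? mins Xs Ys =
  (Fin.all? (λ i → count i Xs ≟ count i Ys)
    ×-dec All.all? (winning? mins) Xs
    ×-dec All.all? (¬? ∘ winning? mins) Ys)
  ×-dec Any.any? (_≟ˢ ⊤) Xs
  ×-dec Any.any? (_≟ˢ ⊥) Ys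

fano-winning⇒3≤size : ∀ X → Winning fanoLines X → 3 ≤ ∣ X ∣
fano-winning⇒3≤size = from-yes (allSubsets? (λ X → winning? fanoLines X →-dec 3 ≤? ∣ X ∣))

fano-losing⇒size≤4 : ∀ Y → Losing fanoLines Y → ∣ Y ∣ ≤ 4
fano-losing⇒size≤4 = from-yes (allSubsets? (λ Y → ¬? (winning? fanoLines Y) →-dec ∣ Y ∣ ≤? 4))

fano-no-short-certificate : (j : ℕ) → j < 8 → ¬ HasPotentCertificateOfLength fanoLines j
fano-no-short-certificate j j<8 certificate = <⇒≱ j<8 (+-cancelʳ-≤ (j * 3) 8 j (begin
    8 + j * 3       ≡⟨ xy∙z≈xz∙y 4 (j * 3) 4 ⟨
    4 + j * 3 + 4   ≤⟨ potentCertificate⇒length-bound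
                         fano-winning⇒3≤size fano-losing⇒size≤4 ≤-refl ≤-refl certificate ⟩
    j * 4           ≡⟨ *-suc j 3 ⟩
    j + j * 3       ∎))
  where open ≤-Reasoning

fanoCertificate : HasPotentCertificateOfLength fanoLines 8
fanoCertificate =
  grandAndLines , emptyAndCoLines , from-yes (potentCertificate? fanoLines grandAndLines emptyAndCoLines)
  where
    lines : Vec (Subset 7) 7
    lines = fromList fanoLines
    grandAndLines emptyAndCoLines : Vec (Subset 7) 8
    grandAndLines   = ⊤ ∷ lines
    emptyAndCoLines = ⊥ ∷ map ∁ lines

theorem10 : gEquals fanoLines 8
theorem10 = fanoCertificate , fano-no-short-certificate
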